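{- Let $k$ be a fixed positive integer. Then: (i) if $m,n$ are positive integers with $n\mid m$, then $\Phi_k(n)\mid\Phi_k(m)$; (ii) if $m,n$ are positive integers and $d=\gcd(m,n)$, then $\Phi_k(mn)\Phi_k(d) = d^k \Phi_k(m)\Phi_k(n)$; (iii) if $n,m$ are positive integers, then $\Phi_k(n^m)=n^{km-k}\Phi_k(n)$.
   Context: For positive integers $k,n$, $\Phi_k(n)$ denotes the number of $k$-tuples $(x_1,\ldots,x_k)\in(\mathbb{Z}/n\mathbb{Z})^k$ such that $\gcd(x_1^2+\cdots+x_k^2,n)=1$. -}

module Defs where

open import Data.Nat using (ℕ; zero; suc; _+_; _*_)
open import Data.Nat.GCD using (gcd)
open import Data.Fin using (Fin; toℕ)
open import Data.List using (List; []; _∷_; map; concatMap; length; filter; allFin)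
open import Data.Vec using (Vec; []; _∷_)
open import Data.Nat.Properties using (_≟_)

-- All k-tuples of residues mod n, i.e. (ℤ/nℤ)^k, with ℤ/nℤ represented by Fin n
-- (canonical representatives 0,…,n-1).
tuples : (k n : ℕ) → List (Vec (Fin n) k)
tuples zero    n = [] ∷ []
tuples (suc k) n = concatMap (λ x → map (x ∷_) (tuples k n)) (allFin n)

-- x₁² + ⋯ + x_k² computed on representatives (gcd with n only depends on the residue).
sumSq : {k n : ℕ} → Vec (Fin n) k → ℕ
sumSq []       = 0
sumSq (x ∷ xs) = toℕ x * toℕ x + sumSq xs

Φ : (k n : ℕ) → ℕ
Φ k n = length (filter (λ v → gcd (sumSq v) n ≟ 1) (tuples k n))

module Submission where

-- Write χ_n(s) = [gcd(s, n) = 1] and S_k(n, h) = Σ_{x ∈ {0,…,n-1}^k} h(x₁² + ⋯ + x_k²),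
-- so that Φ_k(n) = S_k(n, χ_n).  Two facts about S_k drive everything:
--   * (CRT)   if gcd(a, b) = 1, f is a-periodic and g is b-periodic, then
--             S_k(ab, f·g) = S_k(a, f) · S_k(b, g);
--   * (lift)  if h is n-periodic, then S_k(qn, h) = q^k · S_k(n, h).
-- Since χ_{ab} = χ_a · χ_b and χ_x = χ_d whenever d ∣ x ∣ d^N, these give
--   Φ_k(ab) = Φ_k(a) Φ_k(b) for coprime a, b,   and   Φ_k(αd) = α^k Φ_k(d) if αd ∣ d^N.
-- Every a ≥ 1 splits as a = u·v with u ∣ d^N and gcd(v, d) = 1; if moreover d ∣ a then
-- u = αd and Φ_k(a) = α^k Φ_k(d) Φ_k(v).  Claim (i) splits m with respect to n; claim (ii)
-- splits m and n with respect to gcd(m, n) and multiplies the splittings to get one of mn;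
-- claim (iii) is the lift applied to n^m = n^(m-1) · n.

open import Defs
open import Data.Nat
  using (ℕ; zero; suc; _+_; _*_; _^_; _∸_; _≤_; _<_; _≥_; z≤n; s≤s; _%_; _/_; NonZero; NonTrivial; >-nonZero; >-nonZero⁻¹; n>1⇒nonTrivial)
open import Data.Nat.Properties
  using ( _≟_; +-assoc; +-comm; +-identityʳ; +-cancelˡ-≡; *-assoc; *-comm; *-identityˡ; *-identityʳ
        ; ≤-total; ≤-antisym; ≤-<-trans; m∸n≤m; m∸n≡0⇒m≤n; m+[n∸m]≡n; m+n∸m≡n; *-suc
        ; ^-*-assoc; ^-distribˡ-+-*; m<n⇒n≢0; 1+n≰n )
open import Data.Nat.DivMod using (m≡m%n+[m/n]*n; m%n<n)
open import Data.Nat.Divisibility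
  using (_∣_; divides; quotient; ∣-refl; ∣-trans; ∣-reflexive; n∣m*n; ∣m∣n⇒∣m+n; ∣m+n∣m⇒∣n
        ; *-pres-∣; >⇒∤; quotient-<; quotient≢0; m∣n⇒n≡quotient*m)
open import Data.Nat.GCD using (gcd; gcd[m,n]∣m; gcd[m,n]∣n; gcd-greatest; gcd[m,n]≢0)
open import Data.Nat.Coprimality as Coprime
  using (Coprime; coprime?; coprime-divisor; coprime-+; 1-coprimeTo; gcd≡1⇒coprime; coprime⇒gcd≡1)
open import Data.Nat.Induction using (<-rec)
open import Data.Nat.ListAction using () renaming (sum to listSum)
open import Data.Nat.ListAction.Properties using (sum-++)
open import Data.Nat.Tactic.RingSolver using (solve-∀)
open import Data.Fin using (Fin; toℕ; fromℕ<; punchOut) renaming (_≟_ to _≟ᶠ_)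
open import Data.Fin.Properties using (any?; punchOut-injective; injective⇒≤; toℕ-fromℕ<; toℕ-injective; toℕ<n)
open import Data.Fin.Permutation using (permutation)
open import Data.List using (List; []; _∷_; _++_; map; concatMap; length; filter; allFin; tabulate)
open import Data.List.Properties using (map-cong; map-++; map-∘; map-tabulate)
open import Data.Vec using (_∷_)
open import Data.Bool using (true; false; if_then_else_)
open import Data.Product using (_×_; _,_; ∃; ∃-syntax; proj₁; proj₂)
open import Data.Sum using (inj₁; inj₂)
open import Data.Empty using (⊥-elim)
open import Function.Definitions using (Injective)
open import Relation.Nullary using (Dec; yes; no; does; ¬_; contradiction; _×-dec_)
open import Relation.Binary.PropositionalEquality
open ≡-Reasoning
open import Algebra.Properties.Semiring.Sum Data.Nat.Properties.+-*-semiring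
  using (sum; sum-cong-≗; ∑-comm; sum-permute; *-distribˡ-sum; *-distribʳ-sum)

-- Σ n f = f 0 + f 1 + ⋯ + f (n-1).  It is the library sum over Fin n, so the library's
-- summation lemmas apply, and it unfolds definitionally as Σ (suc n) f = f 0 + Σ n (f ∘ suc).
Σ : ℕ → (ℕ → ℕ) → ℕ
Σ n f = sum (λ (i : Fin n) → f (toℕ i))

Σ-cong : ∀ n {f g : ℕ → ℕ} → (∀ i → f i ≡ g i) → Σ n f ≡ Σ n g
Σ-cong n f≗g = sum-cong-≗ {n} (λ i → f≗g (toℕ i))

Σ-*ˡ : ∀ n c (f : ℕ → ℕ) → Σ n (λ i → c * f i) ≡ c * Σ n f
Σ-*ˡ n c f = sym (*-distribˡ-sum {n} c (λ i → f (toℕ i)))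

Σ-*ʳ : ∀ n c (f : ℕ → ℕ) → Σ n (λ i → f i * c) ≡ Σ n f * c
Σ-*ʳ n c f = sym (*-distribʳ-sum {n} c (λ i → f (toℕ i)))

Σ-comm : ∀ a b (A : ℕ → ℕ → ℕ) → Σ a (λ i → Σ b (A i)) ≡ Σ b (λ j → Σ a (λ i → A i j))
Σ-comm a b A = ∑-comm {a} {b} (λ i j → A (toℕ i) (toℕ j))

Σ-+ : ∀ a b (f : ℕ → ℕ) → Σ (a + b) f ≡ Σ a f + Σ b (λ i → f (a + i))
Σ-+ zero    b f = refl
Σ-+ (suc a) b f = trans (cong (f 0 +_) (Σ-+ a b (λ i → f (suc i)))) (sym (+-assoc (f 0) _ _))

-- Every x < a·b is uniquely i·b + j with i < a, j < b.
Σ-block : ∀ a b (f : ℕ → ℕ) → Σ (a * b) f ≡ Σ a (λ i → Σ b (λ j → f (i * b + j)))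
Σ-block zero    b f = refl
Σ-block (suc a) b f = trans (Σ-+ b (a * b) f) (cong (Σ b f +_) (trans (Σ-block a b (λ x → f (b + x)))
  (Σ-cong a (λ i → Σ-cong b (λ j → cong f (sym (+-assoc b (i * b) j)))))))

injective⇒surjective : ∀ {n} (π : Fin n → Fin n) → Injective _≡_ _≡_ π → ∀ y → ∃ λ x → π x ≡ y
injective⇒surjective {suc n} π π-inj y with any? (λ x → π x ≟ᶠ y)
... | yes hit = hit
... | no  miss = contradiction (injective⇒≤ punched-inj) 1+n≰n
  where
  avoids : ∀ x → y ≢ π x
  avoids x y≡πx = miss (x , sym y≡πx)
  punched : Fin (suc n) → Fin n
  punched x = punchOut (avoids x)
  punched-inj : Injective _≡_ _≡_ punched
  punched-inj {x} {x′} eq = π-inj (punchOut-injective (avoids x) (avoids x′) eq)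

Σ-reindex : ∀ n (ρ : ℕ → ℕ) → (∀ i → i < n → ρ i < n) →
  (∀ {i j} → i < n → j < n → ρ i ≡ ρ j → i ≡ j) →
  (f : ℕ → ℕ) → Σ n (λ i → f (ρ i)) ≡ Σ n f
Σ-reindex n ρ ρ<n ρ-inj f = sym (begin
    Σ n f                                  ≡⟨ sum-permute (λ i → f (toℕ i)) (permutation π π⁻¹ π∘π⁻¹ π⁻¹∘π) ⟩
    sum (λ (i : Fin n) → f (toℕ (π i)))   ≡⟨ sum-cong-≗ (λ i → cong f (toℕ-fromℕ< (ρ<n (toℕ i) (toℕ<n i)))) ⟩
    Σ n (λ i → f (ρ i))                    ∎)
  where
  π : Fin n → Fin n
  π i = fromℕ< (ρ<n (toℕ i) (toℕ<n i))
  π-inj : Injective _≡_ _≡_ π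
  π-inj {i} {j} eq = toℕ-injective (ρ-inj (toℕ<n i) (toℕ<n j)
    (trans (sym (toℕ-fromℕ< _)) (trans (cong toℕ eq) (toℕ-fromℕ< _))))
  π⁻¹ : Fin n → Fin n
  π⁻¹ y = proj₁ (injective⇒surjective π π-inj y)
  π∘π⁻¹ : ∀ y → π (π⁻¹ y) ≡ y
  π∘π⁻¹ y = proj₂ (injective⇒surjective π π-inj y)
  π⁻¹∘π : ∀ x → π⁻¹ (π x) ≡ x
  π⁻¹∘π x = π-inj (π∘π⁻¹ (π x))

-- h has period n.  (For n = 0 this holds for every h.)
Periodic : ℕ → (ℕ → ℕ) → Set
Periodic n h = ∀ s → h (n + s) ≡ h s

periodic-multiple : ∀ {n h} → Periodic n h → ∀ q s → h (q * n + s) ≡ h s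
periodic-multiple per zero    s = refl
periodic-multiple {n} {h} per (suc q) s =
  trans (cong h (+-assoc n (q * n) s)) (trans (per (q * n + s)) (periodic-multiple per q s))

periodic-mod : ∀ {n h} .{{_ : NonZero n}} → Periodic n h → ∀ s → h (s % n) ≡ h s
periodic-mod {n} {h} per s = sym (begin
  h s                    ≡⟨ cong h (trans (m≡m%n+[m/n]*n s n) (+-comm (s % n) _)) ⟩
  h (s / n * n + s % n)  ≡⟨ periodic-multiple per (s / n) (s % n) ⟩
  h (s % n)              ∎)

%-+-≡⇒∣ : ∀ x y a .{{_ : NonZero a}} → (x + y) % a ≡ x % a → a ∣ y
%-+-≡⇒∣ x y a eq = ∣m+n∣m⇒∣n (subst (a ∣_) (sym quotients) (n∣m*n ((x + y) / a))) (n∣m*n (x / a))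
  where
  quotients : x / a * a + y ≡ (x + y) / a * a
  quotients = +-cancelˡ-≡ (x % a) _ _ (begin
    x % a + (x / a * a + y)        ≡⟨ sym (+-assoc (x % a) _ y) ⟩
    x % a + x / a * a + y          ≡⟨ cong (_+ y) (sym (m≡m%n+[m/n]*n x a)) ⟩
    x + y                          ≡⟨ m≡m%n+[m/n]*n (x + y) a ⟩
    (x + y) % a + (x + y) / a * a  ≡⟨ cong (_+ (x + y) / a * a) eq ⟩
    x % a + (x + y) / a * a        ∎)

multiple-below⇒0 : ∀ {a e} → a ∣ e → e < a → e ≡ 0
multiple-below⇒0 {e = zero}  _   _   = refl
multiple-below⇒0 {e = suc _} a∣e e<a = contradiction a∣e (>⇒∤ e<a)

-- For b coprime to a, the affine map i ↦ i·b + c is injective modulo a on {0,…,a-1}: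
-- for i ≤ j < a, a divides (j - i)·b, hence j - i, hence j - i = 0.
affine-injective-≤ : ∀ {a b} c .{{_ : NonZero a}} → Coprime a b →
  ∀ {i j} → i ≤ j → j < a → (i * b + c) % a ≡ (j * b + c) % a → i ≡ j
affine-injective-≤ {a} {b} c a⊥b {i} {j} i≤j j<a eq =
  ≤-antisym i≤j (m∸n≡0⇒m≤n (multiple-below⇒0 a∣j∸i (≤-<-trans (m∸n≤m j i) j<a)))
  where
  shift : ∀ i e b c → (i + e) * b + c ≡ (i * b + c) + e * b
  shift = solve-∀
  j-expanded : j * b + c ≡ (i * b + c) + (j ∸ i) * b
  j-expanded = trans (cong (λ t → t * b + c) (sym (m+[n∸m]≡n i≤j))) (shift i (j ∸ i) b c)
  a∣j∸i : a ∣ j ∸ i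
  a∣j∸i = coprime-divisor a⊥b (subst (a ∣_) (*-comm (j ∸ i) b)
    (%-+-≡⇒∣ (i * b + c) _ a (trans (cong (_% a) (sym j-expanded)) (sym eq))))

affine-injective : ∀ {a b} c .{{_ : NonZero a}} → Coprime a b →
  ∀ {i j} → i < a → j < a → (i * b + c) % a ≡ (j * b + c) % a → i ≡ j
affine-injective c a⊥b {i} {j} i<a j<a eq with ≤-total i j
... | inj₁ i≤j = affine-injective-≤ c a⊥b i≤j j<a eq
... | inj₂ j≤i = sym (affine-injective-≤ c a⊥b j≤i i<a (sym eq))

Σ-periodic : ∀ q {n F} → Periodic n F → Σ (q * n) F ≡ q * Σ n F
Σ-periodic zero    per = refl
Σ-periodic (suc q) {n} {F} per = begin
  Σ (n + q * n) F                          ≡⟨ Σ-+ n (q * n) F ⟩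
  Σ n F + Σ (q * n) (λ x → F (n + x))      ≡⟨ cong (Σ n F +_) (Σ-cong (q * n) per) ⟩
  Σ n F + Σ (q * n) F                      ≡⟨ cong (Σ n F +_) (Σ-periodic q per) ⟩
  Σ n F + q * Σ n F                        ∎

-- For b coprime to a, {i·b + c : i < a} is a complete residue system modulo a, so an
-- a-periodic function has the same sum over it as over {0,…,a-1}.
Σ-affine : ∀ {a b} c → Coprime a b → ∀ {F} → Periodic a F → Σ a (λ i → F (i * b + c)) ≡ Σ a F
Σ-affine {zero} c a⊥b per = refl
Σ-affine {a@(suc _)} {b} c a⊥b {F} per = begin
  Σ a (λ i → F (i * b + c))        ≡⟨ Σ-cong a (λ i → sym (periodic-mod per (i * b + c))) ⟩
  Σ a (λ i → F ((i * b + c) % a))  ≡⟨ Σ-reindex a (λ i → (i * b + c) % a) (λ i _ → m%n<n (i * b + c) a)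
                                        (affine-injective c a⊥b) F ⟩
  Σ a F                            ∎

-- Chinese remainder theorem for sums: writing x < a·b as i·b + j, the factor G(x) = G(j)
-- only sees j, and for fixed j the index i·b + j runs over all residues modulo a.
Σ-CRT : ∀ {a b} → Coprime a b → ∀ {F G} → Periodic a F → Periodic b G →
  Σ (a * b) (λ x → F x * G x) ≡ Σ a F * Σ b G
Σ-CRT {a} {b} a⊥b {F} {G} perF perG = begin
  Σ (a * b) (λ x → F x * G x)                              ≡⟨ Σ-block a b (λ x → F x * G x) ⟩
  Σ a (λ i → Σ b (λ j → F (i * b + j) * G (i * b + j)))    ≡⟨ Σ-cong a (λ i → Σ-cong b (λ j →
                                                                cong (F (i * b + j) *_) (periodic-multiple perG i j))) ⟩
  Σ a (λ i → Σ b (λ j → F (i * b + j) * G j))              ≡⟨ Σ-comm a b (λ i j → F (i * b + j) * G j) ⟩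
  Σ b (λ j → Σ a (λ i → F (i * b + j) * G j))              ≡⟨ Σ-cong b (λ j → Σ-*ʳ a (G j) (λ i → F (i * b + j))) ⟩
  Σ b (λ j → Σ a (λ i → F (i * b + j)) * G j)              ≡⟨ Σ-cong b (λ j → cong (_* G j) (Σ-affine j a⊥b perF)) ⟩
  Σ b (λ j → Σ a F * G j)                                  ≡⟨ Σ-*ˡ b (Σ a F) G ⟩
  Σ a F * Σ b G                                            ∎

-- S k n h = Σ over x ∈ {0,…,n-1}^k of h(x₁² + ⋯ + x_k²), peeling off one coordinate
-- at a time: the remaining coordinates see h shifted by x₁².
S : ℕ → ℕ → (ℕ → ℕ) → ℕ
S zero    n h = h 0
S (suc k) n h = Σ n (λ x → S k n (λ s → h (x * x + s)))

S-cong : ∀ k n {h h′ : ℕ → ℕ} → (∀ s → h s ≡ h′ s) → S k n h ≡ S k n h′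
S-cong zero    n h≗h′ = h≗h′ 0
S-cong (suc k) n h≗h′ = Σ-cong n (λ x → S-cong k n (λ s → h≗h′ (x * x + s)))

periodic-shift : ∀ {n h} → Periodic n h → ∀ c → Periodic n (λ s → h (c + s))
periodic-shift {n} {h} per c s = trans (cong h (swap c n s)) (per (c + s))
  where
  swap : ∀ c n s → c + (n + s) ≡ n + (c + s)
  swap = solve-∀

-- The summand of S (suc k) is n-periodic in x, because (x + n)² ≡ x² (mod n).
periodic-summand : ∀ k N {n h} → Periodic n h → Periodic n (λ x → S k N (λ s → h (x * x + s)))
periodic-summand k N {n} {h} per x = S-cong k N (λ s →
  trans (cong h (square-shift n x s)) (periodic-multiple per (n + x + x) (x * x + s)))
  where
  square-shift : ∀ n x s → (n + x) * (n + x) + s ≡ (n + x + x) * n + (x * x + s)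
  square-shift = solve-∀

-- Lift: over q·n, each of the k coordinates runs through q periods of n.
S-lift : ∀ k q {n h} → Periodic n h → S k (q * n) h ≡ q ^ k * S k n h
S-lift zero    q {h = h} per = sym (+-identityʳ (h 0))
S-lift (suc k) q {n} {h} per = begin
  Σ (q * n) (λ x → S k (q * n) (h² x))       ≡⟨ Σ-cong (q * n) (λ x → S-lift k q (periodic-shift per (x * x))) ⟩
  Σ (q * n) (λ x → q ^ k * S k n (h² x))     ≡⟨ Σ-*ˡ (q * n) (q ^ k) (λ x → S k n (h² x)) ⟩
  q ^ k * Σ (q * n) (λ x → S k n (h² x))     ≡⟨ cong (q ^ k *_) (Σ-periodic q (periodic-summand k n per)) ⟩
  q ^ k * (q * Σ n (λ x → S k n (h² x)))     ≡⟨ sym (*-assoc (q ^ k) q _) ⟩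
  q ^ k * q * Σ n (λ x → S k n (h² x))       ≡⟨ cong (_* Σ n (λ x → S k n (h² x))) (*-comm (q ^ k) q) ⟩
  q * q ^ k * Σ n (λ x → S k n (h² x))       ∎
  where
  h² : ℕ → ℕ → ℕ
  h² x s = h (x * x + s)

S-CRT : ∀ k {a b} → Coprime a b → ∀ {f g} → Periodic a f → Periodic b g →
  S k (a * b) (λ s → f s * g s) ≡ S k a f * S k b g
S-CRT zero    a⊥b perf perg = refl
S-CRT (suc k) {a} {b} a⊥b perf perg = trans
  (Σ-cong (a * b) (λ x → S-CRT k a⊥b (periodic-shift perf (x * x)) (periodic-shift perg (x * x))))
  (Σ-CRT a⊥b (periodic-summand k a perf) (periodic-summand k b perg))

𝟙 : ∀ {p} {P : Set p} → Dec P → ℕ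
𝟙 P? = if does P? then 1 else 0

𝟙-cong : ∀ {p q} {P : Set p} {Q : Set q} (P? : Dec P) (Q? : Dec Q) → (P → Q) → (Q → P) → 𝟙 P? ≡ 𝟙 Q?
𝟙-cong (yes _) (yes _) _   _   = refl
𝟙-cong (no  _) (no  _) _   _   = refl
𝟙-cong (yes p) (no ¬q) P→Q _   = contradiction (P→Q p) ¬q
𝟙-cong (no ¬p) (yes q) _   Q→P = contradiction (Q→P q) ¬p

𝟙-× : ∀ {p q} {P : Set p} {Q : Set q} (P? : Dec P) (Q? : Dec Q) → 𝟙 (P? ×-dec Q?) ≡ 𝟙 P? * 𝟙 Q?
𝟙-× (yes _) (yes _) = refl
𝟙-× (yes _) (no  _) = refl
𝟙-× (no  _) _       = refl

length-filter-count : ∀ {a p} {A : Set a} {P : A → Set p} (P? : ∀ x → Dec (P x)) (xs : List A) →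
  length (filter P? xs) ≡ listSum (map (λ x → 𝟙 (P? x)) xs)
length-filter-count P? []       = refl
length-filter-count P? (x ∷ xs) with does (P? x)
... | true  = cong suc (length-filter-count P? xs)
... | false = length-filter-count P? xs

listSum-concatMap : ∀ {a b} {A : Set a} {B : Set b} (w : B → ℕ) (g : A → List B) (xs : List A) →
  listSum (map w (concatMap g xs)) ≡ listSum (map (λ x → listSum (map w (g x))) xs)
listSum-concatMap w g []       = refl
listSum-concatMap w g (x ∷ xs) = begin
  listSum (map w (g x ++ concatMap g xs))
    ≡⟨ cong listSum (map-++ w (g x) _) ⟩
  listSum (map w (g x) ++ map w (concatMap g xs))
    ≡⟨ sum-++ (map w (g x)) _ ⟩
  listSum (map w (g x)) + listSum (map w (concatMap g xs))
    ≡⟨ cong (listSum (map w (g x)) +_) (listSum-concatMap w g xs) ⟩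
  listSum (map w (g x)) + listSum (map (λ y → listSum (map w (g y))) xs)
    ∎

listSum-allFin : ∀ n (f : ℕ → ℕ) → listSum (map (λ (i : Fin n) → f (toℕ i)) (allFin n)) ≡ Σ n f
listSum-allFin n f = trans (cong listSum (map-tabulate (λ (i : Fin n) → i) (λ i → f (toℕ i)))) (tabulated n f)
  where
  tabulated : ∀ n (f : ℕ → ℕ) → listSum (tabulate (λ (i : Fin n) → f (toℕ i))) ≡ Σ n f
  tabulated zero    f = refl
  tabulated (suc n) f = cong (f 0 +_) (tabulated n (λ i → f (suc i)))

listSum-tuples : ∀ k n (h : ℕ → ℕ) → listSum (map (λ v → h (sumSq v)) (tuples k n)) ≡ S k n h
listSum-tuples zero    n h = +-identityʳ (h 0)
listSum-tuples (suc k) n h = begin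
  listSum (map (λ v → h (sumSq v)) (concatMap (λ x → map (x ∷_) (tuples k n)) (allFin n)))
    ≡⟨ listSum-concatMap _ (λ x → map (x ∷_) (tuples k n)) (allFin n) ⟩
  listSum (map (λ x → listSum (map (λ v → h (sumSq v)) (map (x ∷_) (tuples k n)))) (allFin n))
    ≡⟨ cong listSum (map-cong (λ x → trans (cong listSum (sym (map-∘ (tuples k n))))
                                            (listSum-tuples k n (λ s → h (toℕ x * toℕ x + s)))) (allFin n)) ⟩
  listSum (map (λ x → S k n (λ s → h (toℕ x * toℕ x + s))) (allFin n))
    ≡⟨ listSum-allFin n (λ x → S k n (λ s → h (x * x + s))) ⟩
  Σ n (λ x → S k n (λ s → h (x * x + s)))
    ∎

χ : ℕ → ℕ → ℕ
χ n s = 𝟙 (coprime? s n)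

Φ-as-S : ∀ k n → Φ k n ≡ S k n (χ n)
Φ-as-S k n = begin
  length (filter (λ v → gcd (sumSq v) n ≟ 1) (tuples k n))        ≡⟨ length-filter-count _ (tuples k n) ⟩
  listSum (map (λ v → 𝟙 (gcd (sumSq v) n ≟ 1)) (tuples k n))      ≡⟨ cong listSum (map-cong (λ v →
                                                                        𝟙-cong (gcd (sumSq v) n ≟ 1) (coprime? (sumSq v) n)
                                                                               gcd≡1⇒coprime coprime⇒gcd≡1) (tuples k n)) ⟩
  listSum (map (λ v → χ n (sumSq v)) (tuples k n))                ≡⟨ listSum-tuples k n (χ n) ⟩
  S k n (χ n)                                                     ∎

coprime-∣ : ∀ {s x d} → d ∣ x → Coprime s x → Coprime s d
coprime-∣ d∣x s⊥x (i∣s , i∣d) = s⊥x (i∣s , ∣-trans i∣d d∣x)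

coprime-* : ∀ {s a b} → Coprime s a → Coprime s b → Coprime s (a * b)
coprime-* {a = a} s⊥a s⊥b {i} (i∣s , i∣ab) = s⊥b (i∣s , coprime-divisor i⊥a i∣ab)
  where
  i⊥a : Coprime i a
  i⊥a (j∣i , j∣a) = s⊥a (∣-trans j∣i i∣s , j∣a)

coprime-^ : ∀ {s d} N → Coprime s d → Coprime s (d ^ N)
coprime-^ zero    s⊥d = Coprime.sym (1-coprimeTo _)
coprime-^ (suc N) s⊥d = coprime-* s⊥d (coprime-^ N s⊥d)

-- u is supported on d: u divides a power of d, i.e. every prime factor of u divides d.
Supported : ℕ → ℕ → Set
Supported d u = ∃[ N ] u ∣ d ^ N

supported-coprime : ∀ {d u s} → Supported d u → Coprime s d → Coprime s u
supported-coprime (N , u∣d^N) s⊥d = coprime-∣ u∣d^N (coprime-^ N s⊥d)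

χ-* : ∀ a b s → χ (a * b) s ≡ χ a s * χ b s
χ-* a b s = trans
  (𝟙-cong (coprime? s (a * b)) (coprime? s a ×-dec coprime? s b)
    (λ s⊥ab → coprime-∣ (divides b (*-comm a b)) s⊥ab , coprime-∣ (n∣m*n a) s⊥ab)
    (λ (s⊥a , s⊥b) → coprime-* s⊥a s⊥b))
  (𝟙-× (coprime? s a) (coprime? s b))

χ-supported : ∀ {d x} → d ∣ x → Supported d x → ∀ s → χ x s ≡ χ d s
χ-supported d∣x x-supp s = 𝟙-cong (coprime? s _) (coprime? s _) (coprime-∣ d∣x) (supported-coprime x-supp)

-- χ n is n-periodic: s and n + s have the same common divisors with n.
χ-periodic : ∀ n → Periodic n (χ n)
χ-periodic n s = 𝟙-cong (coprime? (n + s) n) (coprime? s n)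
  (λ n+s⊥n (i∣s , i∣n) → n+s⊥n (∣m∣n⇒∣m+n i∣n i∣s , i∣n))
  coprime-+

Φ-* : ∀ k {a b} → Coprime a b → Φ k (a * b) ≡ Φ k a * Φ k b
Φ-* k {a} {b} a⊥b = begin
  Φ k (a * b)                              ≡⟨ Φ-as-S k (a * b) ⟩
  S k (a * b) (χ (a * b))                  ≡⟨ S-cong k (a * b) (χ-* a b) ⟩
  S k (a * b) (λ s → χ a s * χ b s)        ≡⟨ S-CRT k a⊥b (χ-periodic a) (χ-periodic b) ⟩
  S k a (χ a) * S k b (χ b)                ≡⟨ sym (cong₂ _*_ (Φ-as-S k a) (Φ-as-S k b)) ⟩
  Φ k a * Φ k b                            ∎

Φ-lift : ∀ k {d α} → Supported d (α * d) → Φ k (α * d) ≡ α ^ k * Φ k d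
Φ-lift k {d} {α} αd-supp = begin
  Φ k (α * d)                 ≡⟨ Φ-as-S k (α * d) ⟩
  S k (α * d) (χ (α * d))     ≡⟨ S-cong k (α * d) (χ-supported (n∣m*n α) αd-supp) ⟩
  S k (α * d) (χ d)           ≡⟨ S-lift k α (χ-periodic d) ⟩
  α ^ k * S k d (χ d)         ≡⟨ cong (α ^ k *_) (sym (Φ-as-S k d)) ⟩
  α ^ k * Φ k d               ∎

record Splitting (d a : ℕ) : Set where
  field
    dPart coPart     : ℕ
    factorisation    : a ≡ dPart * coPart
    dPart-supported  : Supported d dPart
    coPart-coprime   : Coprime coPart d

open Splitting

splitting-supported : ∀ {d u} → Supported d u → Splitting d u
splitting-supported {u = u} u-supp = record
  { dPart = u ; coPart = 1 ; factorisation = sym (*-identityʳ u)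
  ; dPart-supported = u-supp ; coPart-coprime = 1-coprimeTo _ }

splitting-* : ∀ {d a b} → Splitting d a → Splitting d b → Splitting d (a * b)
splitting-* {d} sa sb = record
  { dPart = dPart sa * dPart sb
  ; coPart = coPart sa * coPart sb
  ; factorisation = trans (cong₂ _*_ (factorisation sa) (factorisation sb))
                          (interchange (dPart sa) (coPart sa) (dPart sb) (coPart sb))
  ; dPart-supported = Na + Nb , subst (_ ∣_) (sym (^-distribˡ-+-* d Na Nb)) (*-pres-∣ ua∣ ub∣)
  ; coPart-coprime = Coprime.sym (coprime-* (Coprime.sym (coPart-coprime sa)) (Coprime.sym (coPart-coprime sb)))
  }
  where
  interchange : ∀ u v u′ v′ → u * v * (u′ * v′) ≡ u * u′ * (v * v′)
  interchange = solve-∀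
  Na Nb : ℕ
  Na = proj₁ (dPart-supported sa)
  Nb = proj₁ (dPart-supported sb)
  ua∣ : dPart sa ∣ d ^ Na
  ua∣ = proj₂ (dPart-supported sa)
  ub∣ : dPart sb ∣ d ^ Nb
  ub∣ = proj₂ (dPart-supported sb)

noncoprime⇒gcd>1 : ∀ {a d} → 0 < a → ¬ Coprime a d → 1 < gcd a d
noncoprime⇒gcd>1 {a} {d} a>0 ¬a⊥d with gcd a d in g≡
... | zero        = ⊥-elim (gcd[m,n]≢0 a d (inj₁ (m<n⇒n≢0 a>0)) g≡)
... | suc zero    = ⊥-elim (¬a⊥d (gcd≡1⇒coprime g≡))
... | suc (suc _) = s≤s (s≤s z≤n)

-- Every positive a splits: repeatedly divide out gcd(a, d) until what is left is coprime to d.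
split : ∀ d a → 0 < a → Splitting d a
split d = <-rec (λ a → 0 < a → Splitting d a) step
  where
  step : ∀ a → (∀ {b} → b < a → 0 < b → Splitting d b) → 0 < a → Splitting d a
  step a rec a>0 with coprime? a d
  ... | yes a⊥d = record
    { dPart = 1 ; coPart = a ; factorisation = sym (*-identityˡ a)
    ; dPart-supported = 0 , ∣-refl ; coPart-coprime = a⊥d }
  ... | no ¬a⊥d = subst (Splitting d) (sym (m∣n⇒n≡quotient*m g∣a))
      (splitting-* (rec q<a q>0) g-splitting)
    where
    g-splitting : Splitting d (gcd a d)
    g-splitting = splitting-supported (1 , subst (gcd a d ∣_) (sym (*-identityʳ d)) (gcd[m,n]∣n a d))
    g∣a : gcd a d ∣ a
    g∣a = gcd[m,n]∣m a d
    instance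
      a≢0 : NonZero a
      a≢0 = >-nonZero a>0
      g-nontrivial : NonTrivial (gcd a d)
      g-nontrivial = n>1⇒nonTrivial (noncoprime⇒gcd>1 a>0 ¬a⊥d)
    q<a : quotient g∣a < a
    q<a = quotient-< g∣a
    q>0 : 0 < quotient g∣a
    q>0 = >-nonZero⁻¹ _ {{quotient≢0 g∣a}}

coPart-∣ : ∀ {d a} (sp : Splitting d a) → coPart sp ∣ a
coPart-∣ sp = divides (dPart sp) (factorisation sp)

-- If d ∣ a then d divides the d-part, since the co-part is coprime to d.
dPart-divisible : ∀ {d a} → d ∣ a → (sp : Splitting d a) → d ∣ dPart sp
dPart-divisible {d} d∣a sp = coprime-divisor (Coprime.sym (coPart-coprime sp))
  (subst (d ∣_) (trans (factorisation sp) (*-comm (dPart sp) (coPart sp))) d∣a)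

Φ-splitting : ∀ k {d a α} (sp : Splitting d a) → dPart sp ≡ α * d → Φ k a ≡ α ^ k * Φ k d * Φ k (coPart sp)
Φ-splitting k {d} {a} {α} sp u≡αd = begin
  Φ k a                       ≡⟨ cong (Φ k) (factorisation sp) ⟩
  Φ k (u * v)                 ≡⟨ Φ-* k (Coprime.sym (supported-coprime (dPart-supported sp) (coPart-coprime sp))) ⟩
  Φ k u * Φ k v               ≡⟨ cong (λ t → Φ k t * Φ k v) u≡αd ⟩
  Φ k (α * d) * Φ k v         ≡⟨ cong (_* Φ k v) (Φ-lift k (subst (Supported d) u≡αd (dPart-supported sp))) ⟩
  α ^ k * Φ k d * Φ k v       ∎
  where
  u v : ℕ
  u = dPart sp
  v = coPart sp

coprime-via-gcd : ∀ {v w m n} → v ∣ m → w ∣ n → Coprime v (gcd m n) → Coprime v w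
coprime-via-gcd v∣m w∣n v⊥g (i∣v , i∣w) = v⊥g (i∣v , gcd-greatest (∣-trans i∣v v∣m) (∣-trans i∣w w∣n))

^-distribʳ-* : ∀ x y n → (x * y) ^ n ≡ x ^ n * y ^ n
^-distribʳ-* x y zero    = refl
^-distribʳ-* x y (suc n) = trans (cong (x * y *_) (^-distribʳ-* x y n)) (interchange x y (x ^ n) (y ^ n))
  where
  interchange : ∀ x y x′ y′ → x * y * (x′ * y′) ≡ x * x′ * (y * y′)
  interchange = solve-∀

Φ-divisor-∣ : ∀ k m n → m ≥ 1 → n ∣ m → Φ k n ∣ Φ k m
Φ-divisor-∣ k m n m≥1 n∣m = divides (α ^ k * Φ k v) (begin
  Φ k m                     ≡⟨ Φ-splitting k sp (m∣n⇒n≡quotient*m n∣u) ⟩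
  α ^ k * Φ k n * Φ k v     ≡⟨ swap (α ^ k) (Φ k n) (Φ k v) ⟩
  α ^ k * Φ k v * Φ k n     ∎)
  where
  sp : Splitting n m
  sp = split n m m≥1
  n∣u : n ∣ dPart sp
  n∣u = dPart-divisible n∣m sp
  α v : ℕ
  α = quotient n∣u
  v = coPart sp
  swap : ∀ x y z → x * y * z ≡ x * z * y
  swap = solve-∀

-- (ii) Φ k (m n) Φ k (gcd m n) = gcd(m, n)^k Φ k m Φ k n: split m and n with respect to
-- d = gcd(m, n); the product of the two splittings is a splitting of m n.
Φ-gcd : ∀ k m n → m ≥ 1 → n ≥ 1 → Φ k (m * n) * Φ k (gcd m n) ≡ gcd m n ^ k * Φ k m * Φ k n
Φ-gcd k m n m≥1 n≥1 = begin
  Φ k (m * n) * Φ k d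
    ≡⟨ cong (_* Φ k d) (Φ-splitting k (splitting-* sm sn) uₘuₙ≡αβd·d) ⟩
  (α * β * d) ^ k * Φ k d * Φ k (vₘ * vₙ) * Φ k d
    ≡⟨ cong₂ (λ x y → x * Φ k d * y * Φ k d) power (Φ-* k vₘ⊥vₙ) ⟩
  α ^ k * β ^ k * d ^ k * Φ k d * (Φ k vₘ * Φ k vₙ) * Φ k d
    ≡⟨ regroup (α ^ k) (β ^ k) (d ^ k) (Φ k d) (Φ k vₘ) (Φ k vₙ) ⟩
  d ^ k * (α ^ k * Φ k d * Φ k vₘ) * (β ^ k * Φ k d * Φ k vₙ)
    ≡⟨ sym (cong₂ (λ x y → d ^ k * x * y) (Φ-splitting k sm uₘ≡αd) (Φ-splitting k sn uₙ≡βd)) ⟩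
  d ^ k * Φ k m * Φ k n
    ∎
  where
  d : ℕ
  d = gcd m n
  sm : Splitting d m
  sm = split d m m≥1
  sn : Splitting d n
  sn = split d n n≥1
  d∣uₘ : d ∣ dPart sm
  d∣uₘ = dPart-divisible (gcd[m,n]∣m m n) sm
  d∣uₙ : d ∣ dPart sn
  d∣uₙ = dPart-divisible (gcd[m,n]∣n m n) sn
  α β vₘ vₙ : ℕ
  α = quotient d∣uₘ
  β = quotient d∣uₙ
  vₘ = coPart sm
  vₙ = coPart sn
  uₘ≡αd : dPart sm ≡ α * d
  uₘ≡αd = m∣n⇒n≡quotient*m d∣uₘ
  uₙ≡βd : dPart sn ≡ β * d
  uₙ≡βd = m∣n⇒n≡quotient*m d∣uₙ
  uₘuₙ≡αβd·d : dPart sm * dPart sn ≡ α * β * d * d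
  uₘuₙ≡αβd·d = trans (cong₂ _*_ uₘ≡αd uₙ≡βd) (rearrange α β d)
    where
    rearrange : ∀ α β d → α * d * (β * d) ≡ α * β * d * d
    rearrange = solve-∀
  vₘ⊥vₙ : Coprime vₘ vₙ
  vₘ⊥vₙ = coprime-via-gcd (coPart-∣ sm) (coPart-∣ sn) (coPart-coprime sm)
  power : (α * β * d) ^ k ≡ α ^ k * β ^ k * d ^ k
  power = trans (^-distribʳ-* (α * β) d k) (cong (_* d ^ k) (^-distribʳ-* α β k))
  regroup : ∀ a b c p x y → a * b * c * p * (x * y) * p ≡ c * (a * p * x) * (b * p * y)
  regroup = solve-∀

-- (iii) Φ k (n^m) = n^(km - k) Φ k n: n^m = n^(m-1) · n has the same prime factors as n.
Φ-power : ∀ k n m → m ≥ 1 → Φ k (n ^ m) ≡ n ^ (k * m ∸ k) * Φ k n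
Φ-power k n (suc m) _ = begin
  Φ k (n * n ^ m)                ≡⟨ cong (Φ k) (*-comm n (n ^ m)) ⟩
  Φ k (n ^ m * n)                ≡⟨ Φ-lift k (suc m , ∣-reflexive (*-comm (n ^ m) n)) ⟩
  (n ^ m) ^ k * Φ k n            ≡⟨ cong (_* Φ k n) (^-*-assoc n m k) ⟩
  n ^ (m * k) * Φ k n            ≡⟨ cong (λ e → n ^ e * Φ k n) exponent ⟩
  n ^ (k * suc m ∸ k) * Φ k n    ∎
  where
  exponent : m * k ≡ k * suc m ∸ k
  exponent = sym (trans (cong (_∸ k) (*-suc k m)) (trans (m+n∸m≡n k (k * m)) (*-comm k m)))

corollary2 : (k : ℕ) → k ≥ 1 →
    ((m n : ℕ) → m ≥ 1 → n ≥ 1 → n ∣ m → Φ k n ∣ Φ k m)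
    × ((m n : ℕ) → m ≥ 1 → n ≥ 1 →
        Φ k (m * n) * Φ k (gcd m n) ≡ gcd m n ^ k * Φ k m * Φ k n)
    × ((n m : ℕ) → n ≥ 1 → m ≥ 1 →
        Φ k (n ^ m) ≡ n ^ (k * m ∸ k) * Φ k n)
corollary2 k _ =
    (λ m n m≥1 _ → Φ-divisor-∣ k m n m≥1)
  , Φ-gcd k
  , (λ n m _ → Φ-power k n m)
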